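{- Fix $k\ge2$ and define $F^{(k)}_1=\cdots=F^{(k)}_k=1$ and $F^{(k)}_{i+1}=F^{(k)}_i+F^{(k)}_{i-1}+\cdots+F^{(k)}_{i-k+1}$ for $i\ge k$. Let $\mathcal{M}^{(k)}$ be the set of all pairs of binary sequences of equal length $n\ge0$, written as $2\times n$ arrays with rows $a_1\cdots a_n$ and $b_1\cdots b_n$, such that $\sum_{i=1}^n a_iF^{(k)}_{i+k-1}=\sum_{i=1}^n b_iF^{(k)}_{i+k-1}$; it is a monoid under concatenation (identity: the empty array). Let $\mathcal{G}^{(k)}$ consist of: the two columns $\binom00$ and $\binom11$; and, for every $j\ge0$ and every $e_1,\dots,e_j\in\{0,1\}$, the two arrays $$\begin{pmatrix}1^k\,e_1\,1^{k-1}\,e_2\,1^{k-1}\cdots e_j\,1^{k-1}\,0\\ 0^k\,e_1\,0^{k-1}\,e_2\,0^{k-1}\cdots e_j\,0^{k-1}\,1\end{pmatrix}\quad\text{and}\quad\begin{pmatrix}0^k\,e_1\,0^{k-1}\,e_2\,0^{k-1}\cdots e_j\,0^{k-1}\,1\\ 1^k\,e_1\,1^{k-1}\,e_2\,1^{k-1}\cdots e_j\,1^{k-1}\,0\end{pmatrix}$$ (each of length $(j+1)k+1$; for $j=0$ these are $\binom{1^k0}{0^k1}$ and $\binom{0^k1}{1^k0}$), where $a^r$ denotes $r$ consecutive copies of the letter $a$. Then $\mathcal{G}^{(k)}\subset\mathcal{M}^{(k)}$ and $\mathcal{G}^{(k)}$ freely generates $\mathcal{M}^{(k)}$: every element of $\mathcal{M}^{(k)}$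 can be written uniquely as a concatenation of elements of $\mathcal{G}^{(k)}$. -}

module Defs where

open import Data.Nat using (ℕ; zero; suc; _+_; _*_; _∸_)
open import Data.Nat.ListAction using (sum)
open import Data.Bool using (Bool; true; false)
open import Data.Product using (_×_; _,_; proj₁; proj₂; Σ; ∃)
open import Data.List using (List; []; _∷_; _++_; replicate; concat; map; zip; length)
open import Data.List.Relation.Unary.All using (All)
open import Relation.Binary.PropositionalEquality using (_≡_)

-- k-generalized Fibonacci numbers, 1-indexed: F k 1 = … = F k k = 1,
-- F k (i+1) = F k i + … + F k (i-k+1) for i ≥ k.
-- window k n = [F(n+1), …, F(n+k)] (the k consecutive values starting at index n+1).
window : ℕ → ℕ → List ℕ
window k zero = replicate k 1
window k (suc n) with window k n
... | [] = []
... | (x ∷ xs) = xs ++ (sum (x ∷ xs) ∷ [])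

headOr0 : List ℕ → ℕ
headOr0 [] = 0
headOr0 (x ∷ _) = x

-- F k i for i ≥ 1 (F k 0 is a junk value, never used below).
F : ℕ → ℕ → ℕ
F k zero = 0
F k (suc n) = headOr0 (window k n)

bit : Bool → ℕ
bit true = 1
bit false = 0

Column : Set
Column = Bool × Bool

-- a 2×n array, as the list of its columns (both rows automatically have length n)
Array : Set
Array = List Column

-- Σ_{i=1}^{n} r_i F^{(k)}_{i+k-1}, where r is the row and the first letter sits at position `pos`
rowValueFrom : ℕ → ℕ → List Bool → ℕ
rowValueFrom k pos [] = 0
rowValueFrom k pos (r ∷ rs) = bit r * F k (pos + k ∸ 1) + rowValueFrom k (suc pos) rs

rowValue : ℕ → List Bool → ℕ
rowValue k r = rowValueFrom k 1 r

topRow : Array → List Bool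
topRow = map proj₁

bottomRow : Array → List Bool
bottomRow = map proj₂

InM : ℕ → Array → Set
InM k w = rowValue k (topRow w) ≡ rowValue k (bottomRow w)

blockRow : ℕ → Bool → List Bool → Bool → List Bool
blockRow k x es y = replicate k x ++ go es
  where
  go : List Bool → List Bool
  go [] = y ∷ []
  go (e ∷ es') = e ∷ replicate (k ∸ 1) x ++ go es'

data Gen : Set where
  col00 : Gen
  col11 : Gen
  upper : List Bool → Gen
  lower : List Bool → Gen

genArray : ℕ → Gen → Array
genArray k col00 = (false , false) ∷ []
genArray k col11 = (true , true) ∷ []
genArray k (upper es) = zip (blockRow k true es false) (blockRow k false es true)
genArray k (lower es) = zip (blockRow k false es true) (blockRow k true es false)

InG : ℕ → Array → Set
InG k w = ∃ λ g → genArray k g ≡ w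

{-# OPTIONS --safe #-}
-- Weight the columns of a tail of an array starting at position t by F t, F (t+1), ….  Since
-- F (t+k) = F t + ⋯ + F (t+k-1), a block 1^k lets the top row run ahead by F (t+k), each
-- e 1^(k-1) passes this debt on by k positions, and the final column (0,1) settles it: the
-- generators are balanced.  Conversely, because F grows strictly but by less than a factor 2, a
-- tail starting beyond position k can close a difference x ≤ 2 F t between its rows only if x is
-- 0, a sum of at most k consecutive values just below t, or F t plus such a sum.  This forces a
-- balanced array beginning with an unequal column to begin with a generator, so generators can
-- be peeled off greedily.  A generator is determined by its first column and its equal columns,
-- so the generators form a prefix code and the factorisation is unique.
module Submission where

open import Defs
open import Data.Bool using (Bool; true; false)
open import Data.Empty using (⊥; ⊥-elim)
open import Function using (_∘_)
open import Data.List using (List; []; _∷_; _++_; replicate; drop; length; map; zip; concat)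
open import Data.List.Properties
  using (length-++; length-replicate; length-map; length-++-≤ʳ; map-∘; map-id; map-++; zip-flip;
         ++-assoc; ++-cancelˡ; ++-conicalˡ)
open import Data.List.Relation.Unary.All using (All; []; _∷_)
open import Data.Nat
open import Data.Nat.ListAction using (sum)
open import Data.Nat.Properties
open import Data.Product using (_×_; _,_; ∃; ∃₂; swap)
open import Relation.Binary.PropositionalEquality
open import Relation.Nullary using (yes; no; ¬_)
open import Data.Sum using (_⊎_; inj₁; inj₂) renaming (swap to ⊎-swap)
open import Data.Nat.Solver using (module +-*-Solver)
open +-*-Solver using (solve; _:+_; _:=_)
open import Algebra.Properties.CommutativeSemigroup +-commutativeSemigroup using (x∙yz≈y∙xz)

module _ {A : Set} (P : List A → Set) (nonempty : ∀ {u} → P u → u ≢ [])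
         (prefix-free : ∀ {u v} x y → P u → P v → u ++ x ≡ v ++ y → u ≡ v) where

  concat-injective : ∀ us vs → All P us → All P vs → concat us ≡ concat vs → us ≡ vs
  concat-injective [] [] _ _ _ = refl
  concat-injective [] (v ∷ vs) _ (pv ∷ _) e = ⊥-elim (nonempty pv (++-conicalˡ v _ (sym e)))
  concat-injective (u ∷ us) [] (pu ∷ _) _ e = ⊥-elim (nonempty pu (++-conicalˡ u _ e))
  concat-injective (u ∷ us) (v ∷ vs) (pu ∷ pus) (pv ∷ pvs) e =
    cong₂ _∷_ u≡v (concat-injective us vs pus pvs
      (++-cancelˡ v _ _ (subst (λ z → z ++ concat us ≡ v ++ concat vs) u≡v e)))
    where
    u≡v : u ≡ v
    u≡v = prefix-free _ _ pu pv e

∸-transfer : ∀ s f x y → s ≤ f → s + x ≡ f + y → y + (f ∸ s) ≡ x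
∸-transfer s f x y s≤f e = +-cancelˡ-≡ s _ _ (begin
  s + (y + (f ∸ s))  ≡⟨ solve 3 (λ s y d → s :+ (y :+ d) := (s :+ d) :+ y) refl s y (f ∸ s) ⟩
  s + (f ∸ s) + y    ≡⟨ cong (_+ y) (m+[n∸m]≡n s≤f) ⟩
  f + y              ≡⟨ sym e ⟩
  s + x              ∎)
  where open ≡-Reasoning

cancel-middle : ∀ s f x y → s + (f + x) ≡ f + y → s + x ≡ y
cancel-middle s f x y e = +-cancelˡ-≡ f _ _ (trans (x∙yz≈y∙xz f s x) e)

positive+≢0 : ∀ s {x} → 1 ≤ s → s + x ≢ 0
positive+≢0 s 1≤s s+x≡0 = n≮0 (subst (1 ≤_) (m+n≡0⇒m≡0 s s+x≡0) 1≤s)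

nth : ℕ → List ℕ → ℕ
nth j xs = headOr0 (drop j xs)

nth-++ˡ : ∀ {j} xs ys → j < length xs → nth j (xs ++ ys) ≡ nth j xs
nth-++ˡ {zero} (x ∷ xs) ys _ = refl
nth-++ˡ {suc j} (x ∷ xs) ys (s≤s j<n) = nth-++ˡ xs ys j<n

nth-last : ∀ xs y → nth (length xs) (xs ++ y ∷ []) ≡ y
nth-last [] y = refl
nth-last (x ∷ xs) y = nth-last xs y

nth-replicate : ∀ {j n} x → j < n → nth j (replicate n x) ≡ x
nth-replicate {zero} {suc n} x _ = refl
nth-replicate {suc j} {suc n} x (s≤s j<n) = nth-replicate x j<n

topRow-swap : ∀ w → topRow (map swap w) ≡ bottomRow w
topRow-swap w = sym (map-∘ w)

bottomRow-swap : ∀ w → bottomRow (map swap w) ≡ topRow w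
bottomRow-swap w = sym (map-∘ w)

map-swap-involutive : ∀ (w : Array) → map swap (map swap w) ≡ w
map-swap-involutive w = trans (sym (map-∘ w)) (map-id w)

blockTail : ℕ → Bool → Bool → List Bool → List Bool
blockTail k x y [] = y ∷ []
blockTail k x y (e ∷ es) = e ∷ replicate (k ∸ 1) x ++ blockTail k x y es

blockTail-unique : ∀ k x y (h : List Bool → List Bool) → h [] ≡ y ∷ [] →
  (∀ e es → h (e ∷ es) ≡ e ∷ replicate (k ∸ 1) x ++ h es) → ∀ es → h es ≡ blockTail k x y es
blockTail-unique k x y h h[] h∷ [] = h[]
blockTail-unique k x y h h[] h∷ (e ∷ es) =
  trans (h∷ e es) (cong (λ r → e ∷ replicate (k ∸ 1) x ++ r) (blockTail-unique k x y h h[] h∷ es))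

-- The local function of blockRow is not in scope; abstracting its first argument with
-- `with e ∷ es` turns its occurrence into a pattern, so unification names it blockRowGo.
mutual
  private
    blockRowGo : ℕ → Bool → Bool → List Bool → List Bool → List Bool
    blockRowGo = _

  blockRow-tail : ∀ k x es y → blockRow k x es y ≡ replicate k x ++ blockTail k x y es
  blockRow-tail k x [] y = refl
  blockRow-tail k x (e ∷ es) y with e ∷ es
  ... | o = cong (λ r → replicate k x ++ e ∷ replicate (k ∸ 1) x ++ r)
    (blockTail-unique k x y (blockRowGo k x y o) refl (λ _ _ → refl) es)

upperTail : ℕ → List Bool → Array
upperTail k [] = (false , true) ∷ []
upperTail k (e ∷ es) = (e , e) ∷ replicate (k ∸ 1) (true , false) ++ upperTail k es

zip-replicate-++ : ∀ n (a b : Bool) xs ys →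
  zip (replicate n a ++ xs) (replicate n b ++ ys) ≡ replicate n (a , b) ++ zip xs ys
zip-replicate-++ zero a b xs ys = refl
zip-replicate-++ (suc n) a b xs ys = cong ((a , b) ∷_) (zip-replicate-++ n a b xs ys)

zip-blockTail : ∀ k es → zip (blockTail k true false es) (blockTail k false true es) ≡ upperTail k es
zip-blockTail k [] = refl
zip-blockTail k (e ∷ es) = cong ((e , e) ∷_)
  (trans (zip-replicate-++ (k ∸ 1) true false _ _) (cong (replicate (k ∸ 1) (true , false) ++_) (zip-blockTail k es)))

upper-shape : ∀ k es → genArray k (upper es) ≡ replicate k (true , false) ++ upperTail k es
upper-shape k es = begin
  zip (blockRow k true es false) (blockRow k false es true)
    ≡⟨ cong₂ zip (blockRow-tail k true es false) (blockRow-tail k false es true) ⟩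
  zip (replicate k true ++ blockTail k true false es) (replicate k false ++ blockTail k false true es)
    ≡⟨ zip-replicate-++ k true false _ _ ⟩
  replicate k (true , false) ++ zip (blockTail k true false es) (blockTail k false true es)
    ≡⟨ cong (replicate k (true , false) ++_) (zip-blockTail k es) ⟩
  replicate k (true , false) ++ upperTail k es ∎
  where open ≡-Reasoning

lower-swap : ∀ k es → genArray k (lower es) ≡ map swap (genArray k (upper es))
lower-swap k es = zip-flip (blockRow k false es true) (blockRow k true es false)

swapGen : Gen → Gen
swapGen col00 = col00
swapGen col11 = col11
swapGen (upper es) = lower es
swapGen (lower es) = upper es

swap-genArray : ∀ k g → map swap (genArray k g) ≡ genArray k (swapGen g)
swap-genArray k col00 = refl
swap-genArray k col11 = refl
swap-genArray k (upper es) = sym (lower-swap k es)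
swap-genArray k (lower es) = trans (cong (map swap) (lower-swap k es)) (map-swap-involutive _)

letters : Array → List Bool
letters [] = []
letters ((false , false) ∷ w) = false ∷ letters w
letters ((true , true) ∷ w) = true ∷ letters w
letters ((true , false) ∷ w) = letters w
letters ((false , true) ∷ _) = []

letters-ones : ∀ n w → letters (replicate n (true , false) ++ w) ≡ letters w
letters-ones zero w = refl
letters-ones (suc n) w = letters-ones n w

letters-upperTail : ∀ k es x → letters (upperTail k es ++ x) ≡ es
letters-upperTail k [] x = refl
letters-upperTail k (e ∷ es) x = begin
  letters ((e , e) ∷ (replicate (k ∸ 1) (true , false) ++ upperTail k es) ++ x)
    ≡⟨ letters-equal-column e _ ⟩
  e ∷ letters ((replicate (k ∸ 1) (true , false) ++ upperTail k es) ++ x)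
    ≡⟨ cong (λ w → e ∷ letters w) (++-assoc (replicate (k ∸ 1) _) (upperTail k es) x) ⟩
  e ∷ letters (replicate (k ∸ 1) (true , false) ++ upperTail k es ++ x)
    ≡⟨ cong (e ∷_) (trans (letters-ones (k ∸ 1) _) (letters-upperTail k es x)) ⟩
  e ∷ es ∎
  where
  open ≡-Reasoning
  letters-equal-column : ∀ e w → letters ((e , e) ∷ w) ≡ e ∷ letters w
  letters-equal-column false w = refl
  letters-equal-column true w = refl

firstGenerator : Array → Gen
firstGenerator [] = col00
firstGenerator ((false , false) ∷ _) = col00
firstGenerator ((true , true) ∷ _) = col11
firstGenerator ((true , false) ∷ w) = upper (letters w)
firstGenerator ((false , true) ∷ w) = lower (letters (map swap w))

upper-++ : ∀ k es x →
  genArray (suc k) (upper es) ++ x ≡ (true , false) ∷ replicate k (true , false) ++ upperTail (suc k) es ++ x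
upper-++ k es x = trans (cong (_++ x) (upper-shape (suc k) es)) (++-assoc (replicate (suc k) _) _ x)

firstGenerator-genArray : ∀ k g x → firstGenerator (genArray (suc k) g ++ x) ≡ g
firstGenerator-genArray k col00 x = refl
firstGenerator-genArray k col11 x = refl
firstGenerator-genArray k (upper es) x = begin
  firstGenerator (genArray (suc k) (upper es) ++ x)            ≡⟨ cong firstGenerator (upper-++ k es x) ⟩
  upper (letters (replicate k _ ++ upperTail (suc k) es ++ x)) ≡⟨ cong upper (letters-ones k _) ⟩
  upper (letters (upperTail (suc k) es ++ x))                  ≡⟨ cong upper (letters-upperTail (suc k) es x) ⟩
  upper es                                                     ∎
  where open ≡-Reasoning
firstGenerator-genArray k (lower es) x = begin
  firstGenerator (genArray (suc k) (lower es) ++ x)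
    ≡⟨ cong (λ w → firstGenerator (w ++ x)) (lower-swap (suc k) es) ⟩
  firstGenerator (map swap (genArray (suc k) (upper es)) ++ x)
    ≡⟨ cong (λ w → firstGenerator (map swap (genArray (suc k) (upper es)) ++ w)) (sym (map-swap-involutive x)) ⟩
  firstGenerator (map swap (genArray (suc k) (upper es)) ++ map swap (map swap x))
    ≡⟨ cong firstGenerator (sym (map-++ swap (genArray (suc k) (upper es)) _)) ⟩
  firstGenerator (map swap (genArray (suc k) (upper es) ++ map swap x))
    ≡⟨ cong (firstGenerator ∘ map swap) (upper-++ k es (map swap x)) ⟩
  lower (letters (map swap (map swap (replicate k _ ++ upperTail (suc k) es ++ map swap x))))
    ≡⟨ cong (lower ∘ letters) (map-swap-involutive (replicate k _ ++ upperTail (suc k) es ++ map swap x)) ⟩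
  lower (letters (replicate k _ ++ upperTail (suc k) es ++ map swap x))
    ≡⟨ cong lower (trans (letters-ones k _) (letters-upperTail (suc k) es (map swap x))) ⟩
  lower es ∎
  where open ≡-Reasoning

generator-nonempty : ∀ k {u} → InG (suc k) u → u ≢ []
generator-nonempty k (col00 , refl) ()
generator-nonempty k (col11 , refl) ()
generator-nonempty k (upper es , refl) ()
generator-nonempty k (lower es , refl) ()

generator-prefix-free : ∀ k {u v} x y → InG (suc k) u → InG (suc k) v → u ++ x ≡ v ++ y → u ≡ v
generator-prefix-free k x y (g , refl) (h , refl) e =
  cong (genArray (suc k))
    (trans (sym (firstGenerator-genArray k g x)) (trans (cong firstGenerator e) (firstGenerator-genArray k h y)))

factorisation-unique : ∀ k gs hs → All (InG (suc k)) gs → All (InG (suc k)) hs →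
  concat gs ≡ concat hs → gs ≡ hs
factorisation-unique k = concat-injective (InG (suc k)) (generator-nonempty k) (generator-prefix-free k)

module KBonacci (k₀ : ℕ) where

  K : ℕ
  K = suc (suc k₀)

  Fk : ℕ → ℕ
  Fk = F K

  Fsum : ℕ → ℕ → ℕ
  Fsum a zero = 0
  Fsum a (suc m) = Fk a + Fsum (suc a) m

  Fsum-snoc : ∀ a m → Fsum a (suc m) ≡ Fsum a m + Fk (a + m)
  Fsum-snoc a zero = trans (+-identityʳ (Fk a)) (cong Fk (sym (+-identityʳ a)))
  Fsum-snoc a (suc m) = begin
    Fk a + Fsum (suc a) (suc m)            ≡⟨ cong (Fk a +_) (Fsum-snoc (suc a) m) ⟩
    Fk a + (Fsum (suc a) m + Fk (suc a + m)) ≡⟨ sym (+-assoc (Fk a) _ _) ⟩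
    Fsum a (suc m) + Fk (suc a + m)          ≡⟨ cong (λ c → Fsum a (suc m) + Fk c) (sym (+-suc a m)) ⟩
    Fsum a (suc m) + Fk (a + suc m)          ∎
    where open ≡-Reasoning

  Fsum-+ : ∀ a e m → Fsum a (e + m) ≡ Fsum a e + Fsum (a + e) m
  Fsum-+ a zero m = cong (λ c → Fsum c m) (sym (+-identityʳ a))
  Fsum-+ a (suc e) m = begin
    Fk a + Fsum (suc a) (e + m)                  ≡⟨ cong (Fk a +_) (Fsum-+ (suc a) e m) ⟩
    Fk a + (Fsum (suc a) e + Fsum (suc a + e) m) ≡⟨ sym (+-assoc (Fk a) _ _) ⟩
    Fsum a (suc e) + Fsum (suc a + e) m          ≡⟨ cong (λ c → Fsum a (suc e) + Fsum c m) (sym (+-suc a e)) ⟩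
    Fsum a (suc e) + Fsum (a + suc e) m          ∎
    where open ≡-Reasoning

  private
    window-shape : ∀ n → ∃₂ λ x xs → window K n ≡ x ∷ xs × length xs ≡ suc k₀
    window-shape zero = 1 , replicate (suc k₀) 1 , refl , length-replicate (suc k₀)
    window-shape (suc n) with window K n | window-shape n
    ... | _ | x , y ∷ ys , refl , ∣ys∣ =
      y , ys ++ sum (x ∷ y ∷ ys) ∷ [] , refl , trans (length-++ ys) (trans (+-comm (length ys) 1) ∣ys∣)

    window-suc : ∀ n {x xs} → window K n ≡ x ∷ xs → window K (suc n) ≡ xs ++ sum (x ∷ xs) ∷ []
    window-suc n eq rewrite eq = refl

    nth-window : ∀ j n → j < K → nth j (window K n) ≡ Fk (suc (j + n))
    nth-window zero n _ = refl
    nth-window (suc j) n (s≤s j<K) with window-shape n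
    ... | x , xs , eq , ∣xs∣ = begin
      nth (suc j) (window K n)          ≡⟨ cong (nth (suc j)) eq ⟩
      nth j xs                          ≡⟨ sym (nth-++ˡ xs _ (subst (j <_) (sym ∣xs∣) j<K)) ⟩
      nth j (xs ++ sum (x ∷ xs) ∷ [])   ≡⟨ cong (nth j) (sym (window-suc n eq)) ⟩
      nth j (window K (suc n))          ≡⟨ nth-window j (suc n) (m<n⇒m<1+n j<K) ⟩
      Fk (suc (j + suc n))              ≡⟨ cong (λ c → Fk (suc c)) (+-suc j n) ⟩
      Fk (suc (suc j + n))              ∎
      where open ≡-Reasoning

    sum-Fsum : ∀ xs a → (∀ j → j < length xs → nth j xs ≡ Fk (a + j)) → sum xs ≡ Fsum a (length xs)
    sum-Fsum [] a _ = refl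
    sum-Fsum (x ∷ xs) a h = cong₂ _+_ (trans (h 0 z<s) (cong Fk (+-identityʳ a)))
      (sum-Fsum xs (suc a) (λ j j< → trans (h (suc j) (s≤s j<)) (cong Fk (+-suc a j))))

  F-init : ∀ j → j < K → Fk (suc j) ≡ 1
  F-init j j<K = trans (sym (trans (nth-window j 0 j<K) (cong (λ c → Fk (suc c)) (+-identityʳ j))))
    (nth-replicate 1 j<K)

  F-rec : ∀ b → 1 ≤ b → Fk (b + K) ≡ Fsum b K
  F-rec (suc n) _ with window-shape n
  ... | x , xs , eq , ∣xs∣ = begin
    Fk (suc n + K)                        ≡⟨ cong (λ c → Fk (suc c)) (trans (+-comm n K) (cong suc (sym (+-suc k₀ n)))) ⟩
    Fk (suc (suc k₀ + suc n))             ≡⟨ sym (nth-window (suc k₀) (suc n) ≤-refl) ⟩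
    nth (suc k₀) (window K (suc n))       ≡⟨ cong (nth (suc k₀)) (window-suc n eq) ⟩
    nth (suc k₀) (xs ++ sum (x ∷ xs) ∷ []) ≡⟨ cong (λ j → nth j (xs ++ sum (x ∷ xs) ∷ [])) (sym ∣xs∣) ⟩
    nth (length xs) (xs ++ sum (x ∷ xs) ∷ []) ≡⟨ nth-last xs _ ⟩
    sum (x ∷ xs)                          ≡⟨ cong sum (sym eq) ⟩
    sum (window K n)                      ≡⟨ sum-Fsum (window K n) (suc n) window-entries ⟩
    Fsum (suc n) (length (window K n))    ≡⟨ cong (λ xs → Fsum (suc n) (length xs)) eq ⟩
    Fsum (suc n) (suc (length xs))        ≡⟨ cong (λ l → Fsum (suc n) (suc l)) ∣xs∣ ⟩
    Fsum (suc n) K                        ∎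
    where
    open ≡-Reasoning
    window-entries : ∀ j → j < length (window K n) → nth j (window K n) ≡ Fk (suc n + j)
    window-entries j j< = trans (nth-window j n (subst (j <_) (trans (cong length eq) (cong suc ∣xs∣)) j<))
      (cong (λ c → Fk (suc c)) (+-comm j n))

  F-≤-suc : ∀ m → Fk (suc m) ≤ Fk (suc (suc m))
  F-≤-suc m with suc m <? K
  ... | yes 1+m<K = ≤-reflexive (trans (F-init m (<⇒≤ 1+m<K)) (sym (F-init (suc m) 1+m<K)))
  ... | no 1+m≮K = begin
    Fk (suc m)                                   ≡⟨ cong Fk (sym last≡1+m) ⟩
    Fk (suc n + suc k₀)                          ≤⟨ m≤n+m _ _ ⟩
    Fsum (suc n) (suc k₀) + Fk (suc n + suc k₀)  ≡⟨ sym (Fsum-snoc (suc n) (suc k₀)) ⟩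
    Fsum (suc n) K                               ≡⟨ sym (F-rec (suc n) z<s) ⟩
    Fk (suc n + K)                               ≡⟨ cong (λ c → Fk (suc c)) n+K≡1+m ⟩
    Fk (suc (suc m))                             ∎
    where
    open ≤-Reasoning
    n : ℕ
    n = suc m ∸ K
    n+K≡1+m : n + K ≡ suc m
    n+K≡1+m = m∸n+n≡m (≮⇒≥ 1+m≮K)
    last≡1+m : suc n + suc k₀ ≡ suc m
    last≡1+m = trans (sym (+-suc n (suc k₀))) n+K≡1+m

  private
    F-mono-≤′ : ∀ {a c} → a ≤′ c → Fk (suc a) ≤ Fk (suc c)
    F-mono-≤′ ≤′-refl = ≤-refl
    F-mono-≤′ {c = suc c} (≤′-step a≤′c) = ≤-trans (F-mono-≤′ a≤′c) (F-≤-suc c)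

  F-mono : ∀ {a c} → 1 ≤ a → a ≤ c → Fk a ≤ Fk c
  F-mono {suc a} {suc c} _ (s≤s a≤c) = F-mono-≤′ (≤⇒≤′ a≤c)

  F-pos : ∀ {t} → 1 ≤ t → 1 ≤ Fk t
  F-pos {t} 1≤t = subst (_≤ Fk t) (F-init 0 z<s) (F-mono ≤-refl 1≤t)

  Fsum-last : ∀ a m → Fk (a + m) ≤ Fsum a (suc m)
  Fsum-last a m = subst (Fk (a + m) ≤_) (sym (Fsum-snoc a m)) (m≤n+m _ _)

  Fsum-pos : ∀ a m → 1 ≤ a → 1 ≤ m → 1 ≤ Fsum a m
  Fsum-pos a (suc m) 1≤a _ = ≤-trans (F-pos 1≤a) (m≤m+n _ _)

  private
    F≡Fsum+Fsum : ∀ a m → m ≤ K → K < a + m → Fk (a + m) ≡ Fsum (a + m ∸ K) (K ∸ m) + Fsum a m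
    F≡Fsum+Fsum a m m≤K K<a+m = begin
      Fk (a + m)                   ≡⟨ cong Fk (sym c+K≡a+m) ⟩
      Fk (c + K)                   ≡⟨ F-rec c (m<n⇒0<n∸m K<a+m) ⟩
      Fsum c K                     ≡⟨ cong (Fsum c) (sym e+m≡K) ⟩
      Fsum c (e + m)               ≡⟨ Fsum-+ c e m ⟩
      Fsum c e + Fsum (c + e) m    ≡⟨ cong (λ d → Fsum c e + Fsum d m) c+e≡a ⟩
      Fsum c e + Fsum a m          ∎
      where
      open ≡-Reasoning
      c : ℕ
      c = a + m ∸ K
      e : ℕ
      e = K ∸ m
      c+K≡a+m : c + K ≡ a + m
      c+K≡a+m = m∸n+n≡m (<⇒≤ K<a+m)
      e+m≡K : e + m ≡ K
      e+m≡K = m∸n+n≡m m≤K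
      c+e≡a : c + e ≡ a
      c+e≡a = +-cancelʳ-≡ m _ _ (trans (+-assoc c e m) (trans (cong (c +_) e+m≡K) c+K≡a+m))

  Fsum-≤-F : ∀ a m → m ≤ K → K < a + m → Fsum a m ≤ Fk (a + m)
  Fsum-≤-F a m m≤K K<a+m = subst (Fsum a m ≤_) (sym (F≡Fsum+Fsum a m m≤K K<a+m)) (m≤n+m _ _)

  Fsum-<-F : ∀ a i → suc i < K → K ≤ a → Fsum a (suc i) < Fk (a + suc i)
  Fsum-<-F a i 1+i<K K≤a = subst (Fsum a (suc i) <_) (sym (F≡Fsum+Fsum a (suc i) (<⇒≤ 1+i<K) K<a+1+i))
    (m<n+m (Fsum a (suc i)) (Fsum-pos (a + suc i ∸ K) (K ∸ suc i) (m<n⇒0<n∸m K<a+1+i) (m<n⇒0<n∸m 1+i<K)))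
    where
    K<a+1+i : K < a + suc i
    K<a+1+i = <-≤-trans (m<m+n K z<s) (+-monoˡ-≤ (suc i) K≤a)

  run-end : ∀ {a i t} → a + suc i ≡ suc t → a + i ≡ t
  run-end {a} {i} e = suc-injective (trans (sym (+-suc a i)) e)

  Gap : ℕ → ℕ → ℕ → Set
  Gap p q x = p + x ≡ q ⊎ q + x ≡ p

  gap-cancelˡ : ∀ f {p q x} → Gap (f + p) (f + q) x → Gap p q x
  gap-cancelˡ f {p} {q} {x} (inj₁ e) = inj₁ (+-cancelˡ-≡ f _ _ (trans (sym (+-assoc f p x)) e))
  gap-cancelˡ f {p} {q} {x} (inj₂ e) = inj₂ (+-cancelˡ-≡ f _ _ (trans (sym (+-assoc f q x)) e))

  data Admissible (t : ℕ) : ℕ → Set where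
    none  : Admissible t 0
    run   : ∀ {a i} → a + suc i ≡ t → i < K → Admissible t (Fsum a (suc i))
    F+run : ∀ {a i} → a + suc i ≡ t → i < K → Admissible t (Fk t + Fsum a (suc i))

  admissible-≥ : ∀ {t x} → 1 ≤ t → Admissible (suc t) x → 1 ≤ x → Fk t ≤ x
  admissible-≥ 1≤t (run {a} {i} e _) _ = subst (λ c → Fk c ≤ Fsum a (suc i)) (run-end e) (Fsum-last a i)
  admissible-≥ 1≤t (F+run _ _) _ = ≤-trans (F-mono 1≤t (n≤1+n _)) (m≤m+n _ _)

  module Above {t : ℕ} (K<t : K < t) where

    private
      b : ℕ
      b = t ∸ K

      1≤b : 1 ≤ b
      1≤b = m<n⇒0<n∸m K<t

      b+K≡t : b + K ≡ t
      b+K≡t = m∸n+n≡m (<⇒≤ K<t)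

      1≤t : 1 ≤ t
      1≤t = <-trans z<s K<t

      C : ℕ
      C = Fsum (suc b) (suc k₀)

      Fb≤C : Fk b ≤ C
      Fb≤C = ≤-trans (F-mono 1≤b (n≤1+n b)) (m≤m+n _ _)

      F-rec-at : Fk t ≡ Fk b + C
      F-rec-at = trans (cong Fk (sym b+K≡t)) (F-rec b 1≤b)

      F-rec-next : Fk (suc t) ≡ C + Fk t
      F-rec-next = begin
        Fk (suc t)                    ≡⟨ cong (λ c → Fk (suc c)) (sym b+K≡t) ⟩
        Fk (suc b + K)                ≡⟨ F-rec (suc b) z<s ⟩
        Fsum (suc b) K                ≡⟨ Fsum-snoc (suc b) (suc k₀) ⟩
        C + Fk (suc b + suc k₀)       ≡⟨ cong (λ c → C + Fk c) (trans (sym (+-suc b (suc k₀))) b+K≡t) ⟩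
        C + Fk t                      ∎
        where open ≡-Reasoning

      F-suc+F-base : Fk (suc t) + Fk b ≡ Fk t + Fk t
      F-suc+F-base = begin
        Fk (suc t) + Fk b             ≡⟨ cong (_+ Fk b) F-rec-next ⟩
        C + Fk t + Fk b               ≡⟨ solve 3 (λ c f g → c :+ f :+ g := f :+ (g :+ c)) refl C (Fk t) (Fk b) ⟩
        Fk t + (Fk b + C)             ≡⟨ cong (Fk t +_) (sym F-rec-at) ⟩
        Fk t + Fk t                   ∎
        where open ≡-Reasoning

    F-<-suc : Fk t < Fk (suc t)
    F-<-suc = subst (Fk t <_) (sym F-rec-next) (m<n+m (Fk t) (≤-trans (F-pos 1≤b) Fb≤C))

    F-suc<2F : Fk (suc t) < Fk t + Fk t
    F-suc<2F = subst (Fk (suc t) <_) F-suc+F-base (m<m+n (Fk (suc t)) (F-pos 1≤b))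

    F-triple : Fk t + (Fk t + Fk t) ≤ Fk (suc t) + Fk (suc t)
    F-triple = begin
      Fk t + (Fk t + Fk t)            ≤⟨ +-monoˡ-≤ (Fk t + Fk t) Ft≤2C ⟩
      (C + C) + (Fk t + Fk t)         ≡⟨ solve 2 (λ c f → (c :+ c) :+ (f :+ f) := (c :+ f) :+ (c :+ f)) refl C (Fk t) ⟩
      (C + Fk t) + (C + Fk t)         ≡⟨ cong₂ _+_ (sym F-rec-next) (sym F-rec-next) ⟩
      Fk (suc t) + Fk (suc t)         ∎
      where
      open ≤-Reasoning
      Ft≤2C : Fk t ≤ C + C
      Ft≤2C = subst (_≤ C + C) (sym F-rec-at) (+-monoˡ-≤ C Fb≤C)

    double-mono : Fk t + Fk t ≤ Fk (suc t) + Fk (suc t)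
    double-mono = +-mono-≤ (<⇒≤ F-<-suc) (<⇒≤ F-<-suc)

    admissible-F : Admissible t (Fk t)
    admissible-F = subst (Admissible t) (sym F-rec-at) (run b+K≡t ≤-refl)

    admissible-2F : Admissible t (Fk t + Fk t)
    admissible-2F = subst (λ x → Admissible t (Fk t + x)) (sym F-rec-at) (F+run b+K≡t ≤-refl)

    private
      ≤F⇒≤2F-suc : ∀ {y} → y ≤ Fk t → y ≤ Fk (suc t) + Fk (suc t)
      ≤F⇒≤2F-suc y≤Ft = ≤-trans y≤Ft (≤-trans (<⇒≤ F-<-suc) (m≤m+n _ _))

      last-run-term : ∀ {a i} → a + suc i ≡ suc t → Fsum a (suc i) ≡ Fk t + Fsum a i
      last-run-term {a} {i} e =
        trans (Fsum-snoc a i) (trans (+-comm (Fsum a i) (Fk (a + i))) (cong (λ c → Fk c + Fsum a i) (run-end e)))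

      F+run-minus-F : ∀ {a i x} → a + suc i ≡ suc t →
        Fk (suc t) + Fsum a (suc i) ≡ Fk t + x → Fk (suc t) + Fsum a i ≡ x
      F+run-minus-F {a} {i} {x} e y≡ = +-cancelˡ-≡ (Fk t) _ _ (begin
        Fk t + (Fk (suc t) + Fsum a i)  ≡⟨ x∙yz≈y∙xz (Fk t) (Fk (suc t)) (Fsum a i) ⟩
        Fk (suc t) + (Fk t + Fsum a i)  ≡⟨ cong (Fk (suc t) +_) (sym (last-run-term e)) ⟩
        Fk (suc t) + Fsum a (suc i)     ≡⟨ y≡ ⟩
        Fk t + x                        ∎)
        where open ≡-Reasoning

    admissible-pred : ∀ {x} → Admissible (suc t) x → x ≤ Fk t + Fk t → Admissible t x
    admissible-pred none _ = none
    admissible-pred (run {a} {zero} e _) _ =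
      subst (Admissible t) (trans (sym (+-identityʳ (Fk t))) (sym (last-run-term e))) admissible-F
    admissible-pred (run {a} {suc i} e i<K) _ =
      subst (Admissible t) (sym (last-run-term e)) (F+run (run-end e) (<⇒≤ i<K))
    admissible-pred (F+run {a} {i} e _) x≤2Ft = ⊥-elim (<⇒≱ 2Ft<x x≤2Ft)
      where
      2Ft<x : Fk t + Fk t < Fk (suc t) + Fsum a (suc i)
      2Ft<x = +-mono-<-≤ F-<-suc (subst (λ c → Fk c ≤ Fsum a (suc i)) (run-end e) (Fsum-last a i))

    admissible-minus-F : ∀ {x y} → Admissible (suc t) y → y ≡ Fk t + x → x ≤ Fk t + Fk t → Admissible t x
    admissible-minus-F {x} none 0≡Ft+x _ = ⊥-elim (positive+≢0 (Fk t) (F-pos 1≤t) (sym 0≡Ft+x))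
    admissible-minus-F (run {a} {zero} e _) y≡ _ =
      subst (Admissible t) (+-cancelˡ-≡ (Fk t) _ _ (trans (sym (last-run-term e)) y≡)) none
    admissible-minus-F (run {a} {suc i} e i<K) y≡ _ =
      subst (Admissible t) (+-cancelˡ-≡ (Fk t) _ _ (trans (sym (last-run-term e)) y≡)) (run (run-end e) (<⇒≤ i<K))
    admissible-minus-F (F+run {a} {zero} e _) y≡ _ =
      subst (Admissible t)
        (trans (+-comm (Fk t) C) (trans (sym F-rec-next) (trans (sym (+-identityʳ _)) (F+run-minus-F e y≡))))
        (F+run (trans (sym (+-suc b (suc k₀))) b+K≡t) (n≤1+n (suc k₀)))
    admissible-minus-F {x} (F+run {a} {suc j} e _) y≡ x≤2Ft =
      subst (Admissible t) (≤-antisym 2Ft≤x x≤2Ft) admissible-2F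
      where
      2Ft≤x : Fk t + Fk t ≤ x
      2Ft≤x = begin
        Fk t + Fk t                   ≡⟨ sym F-suc+F-base ⟩
        Fk (suc t) + Fk b             ≤⟨ +-monoʳ-≤ (Fk (suc t)) (F-mono 1≤b b≤a+j) ⟩
        Fk (suc t) + Fk (a + j)       ≤⟨ +-monoʳ-≤ (Fk (suc t)) (Fsum-last a j) ⟩
        Fk (suc t) + Fsum a (suc j)   ≡⟨ F+run-minus-F e y≡ ⟩
        x                             ∎
        where
        open ≤-Reasoning
        b≤a+j : b ≤ a + j
        b≤a+j = subst (b ≤_) (sym a+j≡b+k₀+1) (m≤m+n b (suc k₀))
          where
          a+j≡b+k₀+1 : a + j ≡ b + suc k₀
          a+j≡b+k₀+1 = suc-injective (trans (sym (+-suc a j)) (trans (run-end e) (trans (sym b+K≡t) (+-suc b (suc k₀)))))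

    admissible-plus-F : ∀ {x y} → Admissible (suc t) y → x ≡ Fk t + y → x ≤ Fk t + Fk t → Admissible t x
    admissible-plus-F {y = zero} _ x≡ _ = subst (Admissible t) (sym (trans x≡ (+-identityʳ _))) admissible-F
    admissible-plus-F {x} {suc y} adm x≡ x≤2Ft =
      subst (Admissible t) (sym (trans x≡ (cong (Fk t +_) y≡Ft))) admissible-2F
      where
      y≡Ft : suc y ≡ Fk t
      y≡Ft = ≤-antisym (+-cancelˡ-≤ (Fk t) _ _ (subst (_≤ Fk t + Fk t) x≡ x≤2Ft)) (admissible-≥ 1≤t adm z<s)

    admissible-complement : ∀ {x y} → Admissible (suc t) y → x + y ≡ Fk t → Admissible t x
    admissible-complement {x} {zero} _ x+0≡Ft =
      subst (Admissible t) (sym (trans (sym (+-identityʳ x)) x+0≡Ft)) admissible-F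
    admissible-complement {x} {suc y} adm x+y≡Ft = subst (Admissible t) (sym x≡0) none
      where
      y≡Ft : suc y ≡ Fk t
      y≡Ft = ≤-antisym (subst (suc y ≤_) x+y≡Ft (m≤n+m _ x)) (admissible-≥ 1≤t adm z<s)
      x≡0 : x ≡ 0
      x≡0 = +-cancelʳ-≡ (suc y) x 0 (trans x+y≡Ft (sym y≡Ft))

    admissible-peel : ∀ {p q x} → Gap (Fk t + p) q x → x ≤ Fk t + Fk t →
      (∀ {y} → Gap p q y → y ≤ Fk (suc t) + Fk (suc t) → Admissible (suc t) y) → Admissible t x
    admissible-peel {p} {q} {x} (inj₁ e) x≤2Ft admissible-next =
      admissible-minus-F (admissible-next (inj₁ e′) (≤-trans (+-monoʳ-≤ (Fk t) x≤2Ft) F-triple)) refl x≤2Ft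
      where
      e′ : p + (Fk t + x) ≡ q
      e′ = trans (solve 3 (λ p f x → p :+ (f :+ x) := f :+ p :+ x) refl p (Fk t) x) e
    admissible-peel {p} {q} {x} (inj₂ e) x≤2Ft admissible-next with Fk t ≤? x
    ... | yes Ft≤x =
      admissible-plus-F (admissible-next (inj₂ e′) (≤F⇒≤2F-suc x∸Ft≤Ft)) (sym (m+[n∸m]≡n Ft≤x)) x≤2Ft
      where
      e′ : q + (x ∸ Fk t) ≡ p
      e′ = +-cancelˡ-≡ (Fk t) _ _
        (trans (x∙yz≈y∙xz (Fk t) q (x ∸ Fk t)) (trans (cong (q +_) (m+[n∸m]≡n Ft≤x)) e))
      x∸Ft≤Ft : x ∸ Fk t ≤ Fk t
      x∸Ft≤Ft = subst (x ∸ Fk t ≤_) (m+n∸m≡n (Fk t) (Fk t)) (∸-monoˡ-≤ (Fk t) x≤2Ft)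
    ... | no Ft≰x =
      admissible-complement (admissible-next (inj₁ e′) (≤F⇒≤2F-suc (m∸n≤m (Fk t) x))) (m+[n∸m]≡n x≤Ft)
      where
      x≤Ft : x ≤ Fk t
      x≤Ft = <⇒≤ (≰⇒> Ft≰x)
      e′ : p + (Fk t ∸ x) ≡ q
      e′ = +-cancelʳ-≡ x _ _ (begin
        p + (Fk t ∸ x) + x      ≡⟨ +-assoc p _ x ⟩
        p + (Fk t ∸ x + x)      ≡⟨ cong (p +_) (m∸n+n≡m x≤Ft) ⟩
        p + Fk t                ≡⟨ +-comm p (Fk t) ⟩
        Fk t + p                ≡⟨ sym e ⟩
        q + x                   ∎)
        where open ≡-Reasoning

  -- The paper's row value Σ r_i F_(i+k-1) is rowAt K (rowValueFrom-rowAt).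
  rowAt : ℕ → List Bool → ℕ
  rowAt t [] = 0
  rowAt t (r ∷ rs) = bit r * Fk t + rowAt (suc t) rs

  topAt : ℕ → Array → ℕ
  topAt t w = rowAt t (topRow w)

  bottomAt : ℕ → Array → ℕ
  bottomAt t w = rowAt t (bottomRow w)

  private
    gap-drop-unit : ∀ f {p q x} → Gap (1 * f + p) q x → Gap (f + p) q x
    gap-drop-unit f {p} {q} {x} = subst (λ c → Gap (c + p) q x) (*-identityˡ f)

  gap-admissible : ∀ w {t x} → K < t → Gap (topAt t w) (bottomAt t w) x → x ≤ Fk t + Fk t → Admissible t x
  gap-admissible [] _ (inj₁ refl) _ = none
  gap-admissible [] _ (inj₂ refl) _ = none
  gap-admissible ((false , false) ∷ w) K<t g x≤2Ft =
    admissible-pred (gap-admissible w (m<n⇒m<1+n K<t) g (≤-trans x≤2Ft double-mono)) x≤2Ft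
    where open Above K<t
  gap-admissible ((true , true) ∷ w) {t} K<t g x≤2Ft =
    admissible-pred (gap-admissible w (m<n⇒m<1+n K<t) (gap-cancelˡ (1 * Fk t) g) (≤-trans x≤2Ft double-mono)) x≤2Ft
    where open Above K<t
  gap-admissible ((true , false) ∷ w) {t} K<t g x≤2Ft =
    admissible-peel (gap-drop-unit (Fk t) g) x≤2Ft (gap-admissible w (m<n⇒m<1+n K<t))
    where open Above K<t
  gap-admissible ((false , true) ∷ w) {t} K<t g x≤2Ft =
    admissible-peel (gap-drop-unit (Fk t) (⊎-swap g)) x≤2Ft
      (gap-admissible w (m<n⇒m<1+n K<t) ∘ ⊎-swap)
    where open Above K<t

  gap-≥ : ∀ w {r x} → K ≤ r → Gap (topAt (suc r) w) (bottomAt (suc r) w) x → 1 ≤ x → Fk r ≤ x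
  gap-≥ w {r} {x} K≤r g 1≤x with x ≤? Fk (suc r) + Fk (suc r)
  ... | yes x≤ = admissible-≥ 1≤r (gap-admissible w (s≤s K≤r) g x≤) 1≤x
    where
    1≤r : 1 ≤ r
    1≤r = ≤-trans (s≤s z≤n) K≤r
  ... | no x≰ = ≤-trans (F-mono (≤-trans (s≤s z≤n) K≤r) (n≤1+n r)) (≤-trans (m≤m+n _ _) (<⇒≤ (≰⇒> x≰)))

  no-double-gap : ∀ w {r} → K < r → ¬ Gap (topAt (suc r) w) (bottomAt (suc r) w) (Fk r + Fk r)
  no-double-gap w {r} K<r g = impossible (gap-admissible w (m<n⇒m<1+n K<r) g double-mono) refl
    where
    open Above K<r
    impossible : ∀ {x} → Admissible (suc r) x → x ≢ Fk r + Fk r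
    impossible none 0≡2Fr = positive+≢0 (Fk r) (F-pos (<-trans z<s K<r)) (sym 0≡2Fr)
    impossible (run {a} {i} e i<K) run≡2Fr = <⇒≱ F-suc<2F (begin
      Fk r + Fk r           ≡⟨ sym run≡2Fr ⟩
      Fsum a (suc i)        ≤⟨ Fsum-≤-F a (suc i) i<K (subst (K <_) (sym e) (m<n⇒m<1+n K<r)) ⟩
      Fk (a + suc i)        ≡⟨ cong Fk e ⟩
      Fk (suc r)            ∎)
      where open ≤-Reasoning
    impossible (F+run {a} {i} e _) F+run≡2Fr = <⇒≱ (+-mono-<-≤ F-<-suc Fr≤run) (≤-reflexive F+run≡2Fr)
      where
      Fr≤run : Fk r ≤ Fsum a (suc i)
      Fr≤run = subst (λ c → Fk c ≤ Fsum a (suc i)) (run-end e) (Fsum-last a i)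

  Balanced : ℕ → Array → Set
  Balanced t w = topAt t w ≡ bottomAt t w

  balanced-swap : ∀ {t} w → Balanced t w → Balanced t (map swap w)
  balanced-swap {t} w bal =
    trans (cong (rowAt t) (topRow-swap w)) (trans (sym bal) (sym (cong (rowAt t) (bottomRow-swap w))))

  rowValueFrom-rowAt : ∀ pos xs → rowValueFrom K pos xs ≡ rowAt (pos + suc k₀) xs
  rowValueFrom-rowAt pos [] = refl
  rowValueFrom-rowAt pos (r ∷ rs) =
    cong₂ _+_ (cong (λ c → bit r * Fk (c ∸ 1)) (+-suc pos (suc k₀))) (rowValueFrom-rowAt (suc pos) rs)

  InM→Balanced : ∀ w → InM K w → Balanced K w
  InM→Balanced w w∈M = trans (sym (rowValueFrom-rowAt 1 (topRow w))) (trans w∈M (rowValueFrom-rowAt 1 (bottomRow w)))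

  Balanced→InM : ∀ w → Balanced K w → InM K w
  Balanced→InM w bal = trans (rowValueFrom-rowAt 1 (topRow w)) (trans bal (sym (rowValueFrom-rowAt 1 (bottomRow w))))

  topAt-ones : ∀ p m u → topAt p (replicate m (true , false) ++ u) ≡ Fsum p m + topAt (p + m) u
  topAt-ones p zero u = cong (λ c → topAt c u) (sym (+-identityʳ p))
  topAt-ones p (suc m) u = begin
    1 * Fk p + topAt (suc p) (replicate m (true , false) ++ u) ≡⟨ cong₂ _+_ (*-identityˡ (Fk p)) (topAt-ones (suc p) m u) ⟩
    Fk p + (Fsum (suc p) m + topAt (suc p + m) u)           ≡⟨ sym (+-assoc (Fk p) _ _) ⟩
    Fsum p (suc m) + topAt (suc p + m) u                     ≡⟨ cong (λ c → Fsum p (suc m) + topAt c u) (sym (+-suc p m)) ⟩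
    Fsum p (suc m) + topAt (p + suc m) u                     ∎
    where open ≡-Reasoning

  bottomAt-ones : ∀ p m u → bottomAt p (replicate m (true , false) ++ u) ≡ bottomAt (p + m) u
  bottomAt-ones p zero u = cong (λ c → bottomAt c u) (sym (+-identityʳ p))
  bottomAt-ones p (suc m) u = trans (bottomAt-ones (suc p) m u) (cong (λ c → bottomAt c u) (sym (+-suc p m)))

  upperTail-owes : ∀ es {r} → 1 ≤ r → Fk r + topAt r (upperTail K es) ≡ bottomAt r (upperTail K es)
  upperTail-owes [] {r} _ = cong (_+ 0) (sym (*-identityˡ (Fk r)))
  upperTail-owes (e ∷ es) {r} 1≤r = begin
    Fk r + (bit e * Fk r + topAt (suc r) (ones ++ tail))
      ≡⟨ cong (λ z → Fk r + (bit e * Fk r + z)) (topAt-ones (suc r) (suc k₀) tail) ⟩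
    Fk r + (bit e * Fk r + (Fsum (suc r) (suc k₀) + topAt (suc r + suc k₀) tail))
      ≡⟨ solve 4 (λ f b c x → f :+ (b :+ (c :+ x)) := b :+ ((f :+ c) :+ x)) refl (Fk r) (bit e * Fk r) (Fsum (suc r) (suc k₀)) _ ⟩
    bit e * Fk r + (Fsum r K + topAt (suc r + suc k₀) tail)
      ≡⟨ cong₂ (λ f c → bit e * Fk r + (f + topAt c tail)) (sym (F-rec r 1≤r)) (sym (+-suc r (suc k₀))) ⟩
    bit e * Fk r + (Fk (r + K) + topAt (r + K) tail)
      ≡⟨ cong (bit e * Fk r +_) (upperTail-owes es (≤-trans 1≤r (m≤m+n r K))) ⟩
    bit e * Fk r + bottomAt (r + K) tail
      ≡⟨ cong (λ c → bit e * Fk r + bottomAt c tail) (+-suc r (suc k₀)) ⟩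
    bit e * Fk r + bottomAt (suc r + suc k₀) tail
      ≡⟨ cong (bit e * Fk r +_) (sym (bottomAt-ones (suc r) (suc k₀) tail)) ⟩
    bit e * Fk r + bottomAt (suc r) (ones ++ tail) ∎
    where
    open ≡-Reasoning
    ones : Array
    ones = replicate (suc k₀) (true , false)
    tail : Array
    tail = upperTail K es

  generator-balanced : ∀ g → Balanced K (genArray K g)
  generator-balanced col00 = refl
  generator-balanced col11 = refl
  generator-balanced (upper es) = subst (Balanced K) (sym (upper-shape K es)) (begin
    topAt K (replicate K (true , false) ++ upperTail K es)  ≡⟨ topAt-ones K K (upperTail K es) ⟩
    Fsum K K + topAt (K + K) (upperTail K es)               ≡⟨ cong (_+ topAt (K + K) (upperTail K es)) (sym (F-rec K z<s)) ⟩
    Fk (K + K) + topAt (K + K) (upperTail K es)             ≡⟨ upperTail-owes es z<s ⟩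
    bottomAt (K + K) (upperTail K es)                       ≡⟨ sym (bottomAt-ones K K (upperTail K es)) ⟩
    bottomAt K (replicate K (true , false) ++ upperTail K es) ∎)
    where open ≡-Reasoning
  generator-balanced (lower es) =
    subst (Balanced K) (swap-genArray K (upper es)) (balanced-swap (genArray K (upper es)) (generator-balanced (upper es)))

  generator-in-M : ∀ w → InG K w → InM K w
  generator-in-M w (g , refl) = Balanced→InM w (generator-balanced g)

  UpperPrefix : ℕ → Array → Set
  UpperPrefix j u = ∃₂ λ es rest →
    u ≡ replicate j (true , false) ++ upperTail K es ++ rest × ∃ λ r → K ≤ r × Balanced r rest

  private
    short-run<F : ∀ {a i j q} → a + suc i ≡ q → suc j + i ≡ suc k₀ → K ≤ a → Fsum a (suc i) < Fk q
    short-run<F {a} {i} {j} a+1+i≡q 1+j+i≡ K≤a = subst (λ c → Fsum a (suc i) < Fk c) a+1+i≡q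
      (Fsum-<-F a i (s≤s (s≤s (subst (i ≤_) (suc-injective 1+j+i≡) (m≤n+m i j)))) K≤a)

    upperPrefix-one : ∀ {j u} → UpperPrefix j u → UpperPrefix (suc j) ((true , false) ∷ u)
    upperPrefix-one (es , rest , u≡ , rest-balanced) = es , rest , cong ((true , false) ∷_) u≡ , rest-balanced

    upperPrefix-letter : ∀ e {u} → UpperPrefix (suc k₀) u → UpperPrefix 0 ((e , e) ∷ u)
    upperPrefix-letter e (es , rest , u≡ , rest-balanced) =
      e ∷ es , rest ,
      cong ((e , e) ∷_) (trans u≡ (sym (++-assoc (replicate (suc k₀) _) (upperTail K es) rest))) ,
      rest-balanced

  -- Inside the leading run of (1,0) columns of a block: the top row lags behind by the i+1
  -- values of F just below position q, and j more (1,0) columns are due.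
  mutual
    parse-run : ∀ {a i q} j u → a + suc i ≡ q → j + i ≡ suc k₀ → K ≤ a →
      Fsum a (suc i) + topAt q u ≡ bottomAt q u → UpperPrefix j u
    parse-run {a} {i} {q} zero u a+K≡q refl K≤a owed =
      parse-owed u (subst (K <_) a+K≡q (m<n+m K 1≤a)) (trans (cong (_+ topAt q u) Fq≡Fsum) owed)
      where
      1≤a : 1 ≤ a
      1≤a = ≤-trans (s≤s z≤n) K≤a
      Fq≡Fsum : Fk q ≡ Fsum a K
      Fq≡Fsum = trans (cong Fk (sym a+K≡q)) (F-rec a 1≤a)
    parse-run {a} {i} {q} (suc j) u a+1+i≡q 1+j+i≡ K≤a = next-column u
      where
      s : ℕ
      s = Fsum a (suc i)
      1≤s : 1 ≤ s
      1≤s = Fsum-pos a (suc i) (≤-trans (s≤s z≤n) K≤a) z<s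
      s<Fq : s < Fk q
      s<Fq = short-run<F a+1+i≡q 1+j+i≡ K≤a
      K≤q : K ≤ q
      K≤q = ≤-trans K≤a (subst (a ≤_) a+1+i≡q (m≤m+n a (suc i)))
      no-small-gap : ∀ u x → Gap (topAt (suc q) u) (bottomAt (suc q) u) x → 1 ≤ x → x < Fk q → ⊥
      no-small-gap u x g 1≤x x<Fq = <⇒≱ x<Fq (gap-≥ u K≤q g 1≤x)
      next-column : ∀ u → s + topAt q u ≡ bottomAt q u → UpperPrefix (suc j) u
      next-column [] owed = ⊥-elim (positive+≢0 s 1≤s owed)
      next-column ((true , false) ∷ u) owed = upperPrefix-one {j} (parse-run j u
        (trans (+-suc a (suc i)) (cong suc a+1+i≡q)) (trans (+-suc j i) 1+j+i≡) K≤a owed′)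
        where
        owed′ : Fsum a (suc (suc i)) + topAt (suc q) u ≡ bottomAt (suc q) u
        owed′ = begin
          Fsum a (suc (suc i)) + topAt (suc q) u  ≡⟨ cong (_+ topAt (suc q) u) (Fsum-snoc a (suc i)) ⟩
          s + Fk (a + suc i) + topAt (suc q) u
            ≡⟨ cong (λ c → s + c + topAt (suc q) u) (trans (cong Fk a+1+i≡q) (sym (*-identityˡ (Fk q)))) ⟩
          s + 1 * Fk q + topAt (suc q) u          ≡⟨ +-assoc s (1 * Fk q) (topAt (suc q) u) ⟩
          s + (1 * Fk q + topAt (suc q) u)        ≡⟨ owed ⟩
          bottomAt (suc q) u                      ∎
          where open ≡-Reasoning
      next-column ((false , false) ∷ u) owed =
        ⊥-elim (no-small-gap u s (inj₁ (trans (+-comm _ s) owed)) 1≤s s<Fq)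
      next-column ((true , true) ∷ u) owed =
        ⊥-elim (no-small-gap u s (inj₁ (trans (+-comm _ s) (cancel-middle s (1 * Fk q) (topAt (suc q) u) _ owed)))
          1≤s s<Fq)
      next-column ((false , true) ∷ u) owed =
        ⊥-elim (no-small-gap u (Fk q ∸ s)
          (inj₂ (∸-transfer s (Fk q) _ _ (<⇒≤ s<Fq) (trans owed (cong (_+ bottomAt (suc q) u) (*-identityˡ (Fk q))))))
          (m<n⇒0<n∸m s<Fq) (∸-monoʳ-< {o = 0} 1≤s (<⇒≤ s<Fq)))

    parse-owed : ∀ {q} u → K < q → Fk q + topAt q u ≡ bottomAt q u → UpperPrefix 0 u
    parse-owed {q} [] K<q owed = ⊥-elim (positive+≢0 (Fk q) (F-pos (<-trans z<s K<q)) owed)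
    parse-owed {q} ((false , true) ∷ u) K<q owed =
      [] , u , refl , suc q , ≤-trans (<⇒≤ K<q) (n≤1+n q) ,
      +-cancelˡ-≡ (Fk q) _ _ (trans owed (cong (_+ bottomAt (suc q) u) (*-identityˡ (Fk q))))
    parse-owed {q} ((true , false) ∷ u) K<q owed = ⊥-elim (no-double-gap u K<q (inj₁ e))
      where
      e : topAt (suc q) u + (Fk q + Fk q) ≡ bottomAt (suc q) u
      e = trans (solve 2 (λ x f → x :+ (f :+ f) := f :+ (f :+ x)) refl (topAt (suc q) u) (Fk q))
        (trans (cong (λ f → Fk q + (f + topAt (suc q) u)) (sym (*-identityˡ (Fk q)))) owed)
    parse-owed {q} ((false , false) ∷ u) K<q owed = upperPrefix-letter false (parse-after-letter u K<q owed)
    parse-owed {q} ((true , true) ∷ u) K<q owed =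
      upperPrefix-letter true (parse-after-letter u K<q (cancel-middle (Fk q) (1 * Fk q) (topAt (suc q) u) _ owed))

    parse-after-letter : ∀ {q} u → K < q → Fk q + topAt (suc q) u ≡ bottomAt (suc q) u → UpperPrefix (suc k₀) u
    parse-after-letter {q} u K<q owed = parse-run (suc k₀) u (+-comm q 1) (+-identityʳ (suc k₀)) (<⇒≤ K<q)
      (trans (cong (_+ topAt (suc q) u) (+-identityʳ (Fk q))) owed)

  Factorisation : Array → Set
  Factorisation w = ∃ λ (gs : List Array) → All (InG K) gs × concat gs ≡ w

  factorisation-cons : ∀ g {rest w} → Factorisation rest → genArray K g ++ rest ≡ w → Factorisation w
  factorisation-cons g (gs , gs∈G , refl) e = genArray K g ∷ gs , (g , refl) ∷ gs∈G , e

  swap-factorisation : ∀ gs → All (InG K) gs → Factorisation (map swap (concat gs))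
  swap-factorisation [] [] = [] , [] , refl
  swap-factorisation (_ ∷ gs) ((g , refl) ∷ gs∈G) = factorisation-cons (swapGen g) (swap-factorisation gs gs∈G)
    (trans (cong (_++ map swap (concat gs)) (sym (swap-genArray K g))) (sym (map-++ swap (genArray K g) (concat gs))))

  factorisation-unswap : ∀ {w} → Factorisation (map swap w) → Factorisation w
  factorisation-unswap {w} (gs , gs∈G , e) =
    subst Factorisation (trans (cong (map swap) e) (map-swap-involutive w)) (swap-factorisation gs gs∈G)

  mutual
    factorise : ∀ n w {t} → length w ≤ n → K ≤ t → Balanced t w → Factorisation w
    factorise n [] _ _ _ = [] , [] , refl
    factorise (suc n) ((false , false) ∷ w) (s≤s ∣w∣≤n) K≤t bal =
      factorisation-cons col00 (factorise n w ∣w∣≤n (m≤n⇒m≤1+n K≤t) bal) refl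
    factorise (suc n) ((true , true) ∷ w) {t} (s≤s ∣w∣≤n) K≤t bal =
      factorisation-cons col11 (factorise n w ∣w∣≤n (m≤n⇒m≤1+n K≤t) (+-cancelˡ-≡ (1 * Fk t) _ _ bal)) refl
    factorise (suc n) ((true , false) ∷ w) (s≤s ∣w∣≤n) K≤t bal = factorise-upper n w ∣w∣≤n K≤t bal
    factorise (suc n) ((false , true) ∷ w) (s≤s ∣w∣≤n) K≤t bal = factorisation-unswap
      (factorise-upper n (map swap w) (subst (_≤ n) (sym (length-map swap w)) ∣w∣≤n) K≤t
        (balanced-swap ((false , true) ∷ w) bal))

    factorise-upper : ∀ n w {t} → length w ≤ n → K ≤ t →
      Balanced t ((true , false) ∷ w) → Factorisation ((true , false) ∷ w)
    factorise-upper n w {t} ∣w∣≤n K≤t bal with parse-run (suc k₀) w (+-comm t 1) (+-identityʳ (suc k₀)) K≤t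
      (trans (cong (_+ topAt (suc t) w) (trans (+-identityʳ (Fk t)) (sym (*-identityˡ (Fk t))))) bal)
    ... | es , rest , w≡ , r , K≤r , rest-balanced =
      factorisation-cons (upper es) (factorise n rest ∣rest∣≤n K≤r rest-balanced)
        (trans (upper-++ (suc k₀) es rest) (cong ((true , false) ∷_) (sym w≡)))
      where
      ∣rest∣≤n : length rest ≤ n
      ∣rest∣≤n = begin
        length rest                                     ≤⟨ length-++-≤ʳ rest {upperTail K es} ⟩
        length (upperTail K es ++ rest)                 ≤⟨ length-++-≤ʳ _ {replicate (suc k₀) (true , false)} ⟩
        length (replicate (suc k₀) _ ++ upperTail K es ++ rest) ≡⟨ cong length (sym w≡) ⟩
        length w                                        ≤⟨ ∣w∣≤n ⟩
        n                                               ∎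
        where open ≤-Reasoning

  M-factorises : ∀ w → InM K w → Factorisation w
  M-factorises w w∈M = factorise (length w) w ≤-refl ≤-refl (InM→Balanced w w∈M)

lemma2 : (k : ℕ) → k ≥ 2 →
    (∀ w → InG k w → InM k w)
    × (∀ w → InM k w → ∃ λ (gs : List Array) → All (InG k) gs × concat gs ≡ w)
    × (∀ (gs hs : List Array) → All (InG k) gs → All (InG k) hs → concat gs ≡ concat hs → gs ≡ hs)
lemma2 (suc (suc k₀)) (s≤s (s≤s z≤n)) = generator-in-M , M-factorises , factorisation-unique (suc k₀)
  where open KBonacci k₀
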